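{- The internal type theory of $\hat{\mathbb{D}}$ justifies terms $c{:}\mathsf{Obj}, d{:}\mathsf{Obj} \vdash \mathsf{arrow\text{ - }e} : (x : \mathsf{El}(\mathsf{arrow}\ c\ d)) \to (y : \mathsf{El}\ c) \to \mathsf{El}\ d$ and $c{:}\mathsf{Obj}, d{:}\mathsf{Obj} \vdash \mathsf{arrow\text{ - }i} : (y : (\mathsf{El}\ c \to \mathsf{El}\ d)) \to \mathsf{El}(\mathsf{arrow}\ c\ d)$ such that $\mathsf{arrow\text{ - }i}\ (\mathsf{arrow\text{ - }e}\ f) = f$ and $\mathsf{arrow\text{ - }e}\ (\mathsf{arrow\text{ - }i}\ g) = g$ for all $f, g$.
   Context: $\mathbb{D}$ is the term model of a simply-typed domain-level lambda-calculus with function and product types: objects are contexts of simple types (identified with product types), morphisms $\Psi\to\Phi$ are substitutions modulo $\alpha\beta\eta$; it is cartesian closed, the exponential of $A$ and $B$ being the function type $A \to B$. $\hat{\mathbb{D}} = [\mathbb{D}^{op},\mathrm{Set}]$ with its standard internal dependent type theory (types in context $\Gamma$ are presheaves on the category of elements of $\Gamma$, terms are sections of projections, function types are the presheaf exponentials/dependent products). $\mathsf{Obj}$ is the constant presheaf of objects of $\mathbb{D}$ (trivial action on morphisms); $\mathsf{arrow} : (a{:}\mathsf{Obj}) \to (b{:}\mathsf{Obj}) \to \mathsf{Obj}$ sends two objects to the code of their exponential in $\mathbb{D}$. $\mathsf{El}$ is the type in context $x:\mathsf{Obj}$ with $\mathsf{El}(\Psi,\Phi) = \mathbb{D}(\Psi,\Phi)$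 and action $f\mapsto f\circ\sigma$ (so $\mathsf{El}\ A \cong \mathrm{y}(A)$). -}

module Defs where

open import Data.Nat using (ℕ)
open import Data.List using (List; []; _∷_)
open import Data.Product using (Σ; _×_; _,_)
open import Relation.Binary.PropositionalEquality
  using (_≡_; refl; cong; cong₂; trans; sym)
open import Relation.Binary.Structures using (IsEquivalence)

infixr 7 _⇒_
infixl 8 _⊗_

data Ty : Set where
  base : ℕ → Ty
  𝟙    : Ty
  _⊗_  : Ty → Ty → Ty
  _⇒_  : Ty → Ty → Ty

Ctx : Set
Ctx = List Ty

data _∋_ : Ctx → Ty → Set where
  here  : ∀ {Γ A} → (A ∷ Γ) ∋ A
  there : ∀ {Γ A B} → Γ ∋ A → (B ∷ Γ) ∋ A

data Tm (Γ : Ctx) : Ty → Set where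
  var  : ∀ {A} → Γ ∋ A → Tm Γ A
  lam  : ∀ {A B} → Tm (A ∷ Γ) B → Tm Γ (A ⇒ B)
  app  : ∀ {A B} → Tm Γ (A ⇒ B) → Tm Γ A → Tm Γ B
  unit : Tm Γ 𝟙
  pair : ∀ {A B} → Tm Γ A → Tm Γ B → Tm Γ (A ⊗ B)
  fst  : ∀ {A B} → Tm Γ (A ⊗ B) → Tm Γ A
  snd  : ∀ {A B} → Tm Γ (A ⊗ B) → Tm Γ B

Ren : Ctx → Ctx → Set
Ren Γ Δ = ∀ {A} → Δ ∋ A → Γ ∋ A

liftR : ∀ {Γ Δ A} → Ren Γ Δ → Ren (A ∷ Γ) (A ∷ Δ)
liftR ρ here      = here
liftR ρ (there x) = there (ρ x)

ren : ∀ {Γ Δ A} → Ren Γ Δ → Tm Δ A → Tm Γ A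
ren ρ (var x)    = var (ρ x)
ren ρ (lam t)    = lam (ren (liftR ρ) t)
ren ρ (app t u)  = app (ren ρ t) (ren ρ u)
ren ρ unit       = unit
ren ρ (pair t u) = pair (ren ρ t) (ren ρ u)
ren ρ (fst t)    = fst (ren ρ t)
ren ρ (snd t)    = snd (ren ρ t)

Sub : Ctx → Ctx → Set
Sub Ψ Φ = ∀ {A} → Φ ∋ A → Tm Ψ A

liftS : ∀ {Γ Δ A} → Sub Γ Δ → Sub (A ∷ Γ) (A ∷ Δ)
liftS σ here      = var here
liftS σ (there x) = ren there (σ x)

sub : ∀ {Γ Δ A} → Sub Γ Δ → Tm Δ A → Tm Γ A
sub σ (var x)    = σ x
sub σ (lam t)    = lam (sub (liftS σ) t)
sub σ (app t u)  = app (sub σ t) (sub σ u)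
sub σ unit       = unit
sub σ (pair t u) = pair (sub σ t) (sub σ u)
sub σ (fst t)    = fst (sub σ t)
sub σ (snd t)    = snd (sub σ t)

single : ∀ {Γ A} → Tm Γ A → Sub Γ (A ∷ Γ)
single u here      = u
single u (there x) = var x

_[_] : ∀ {Γ A B} → Tm (A ∷ Γ) B → Tm Γ A → Tm Γ B
t [ u ] = sub (single u) t

-- αβη-conversion (α is built in: de Bruijn indices)

infix 4 _≈_
data _≈_ : ∀ {Γ A} → Tm Γ A → Tm Γ A → Set where
  ≈refl  : ∀ {Γ A} {t : Tm Γ A} → t ≈ t
  ≈sym   : ∀ {Γ A} {t u : Tm Γ A} → t ≈ u → u ≈ t
  ≈trans : ∀ {Γ A} {t u v : Tm Γ A} → t ≈ u → u ≈ v → t ≈ v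
  lam-cong  : ∀ {Γ A B} {t t' : Tm (A ∷ Γ) B} → t ≈ t' → lam t ≈ lam t'
  app-cong  : ∀ {Γ A B} {t t' : Tm Γ (A ⇒ B)} {u u' : Tm Γ A} →
              t ≈ t' → u ≈ u' → app t u ≈ app t' u'
  pair-cong : ∀ {Γ A B} {t t' : Tm Γ A} {u u' : Tm Γ B} →
              t ≈ t' → u ≈ u' → pair t u ≈ pair t' u'
  fst-cong  : ∀ {Γ A B} {t t' : Tm Γ (A ⊗ B)} → t ≈ t' → fst t ≈ fst t'
  snd-cong  : ∀ {Γ A B} {t t' : Tm Γ (A ⊗ B)} → t ≈ t' → snd t ≈ snd t'
  β⇒  : ∀ {Γ A B} (t : Tm (A ∷ Γ) B) (u : Tm Γ A) → app (lam t) u ≈ t [ u ]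
  η⇒  : ∀ {Γ A B} (t : Tm Γ (A ⇒ B)) → t ≈ lam (app (ren there t) (var here))
  β⊗₁ : ∀ {Γ A B} (t : Tm Γ A) (u : Tm Γ B) → fst (pair t u) ≈ t
  β⊗₂ : ∀ {Γ A B} (t : Tm Γ A) (u : Tm Γ B) → snd (pair t u) ≈ u
  η⊗  : ∀ {Γ A B} (t : Tm Γ (A ⊗ B)) → t ≈ pair (fst t) (snd t)
  η𝟙  : ∀ {Γ} (t : Tm Γ 𝟙) → t ≈ unit

≡→≈ : ∀ {Γ A} {t u : Tm Γ A} → t ≡ u → t ≈ u
≡→≈ refl = ≈refl

ren-cong : ∀ {Γ Δ A} {ρ ρ' : Ren Γ Δ} → (∀ {B} (x : Δ ∋ B) → ρ x ≡ ρ' x) →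
           (t : Tm Δ A) → ren ρ t ≡ ren ρ' t
ren-cong e (var x)    = cong var (e x)
ren-cong {ρ = ρ} {ρ'} e (lam t) = cong lam (ren-cong e' t)
  where
  e' : ∀ {B} x → liftR {A = _} ρ {B} x ≡ liftR ρ' x
  e' here      = refl
  e' (there x) = cong there (e x)
ren-cong e (app t u)  = cong₂ app (ren-cong e t) (ren-cong e u)
ren-cong e unit       = refl
ren-cong e (pair t u) = cong₂ pair (ren-cong e t) (ren-cong e u)
ren-cong e (fst t)    = cong fst (ren-cong e t)
ren-cong e (snd t)    = cong snd (ren-cong e t)

ren-ren : ∀ {Γ Δ Θ A} (ρ : Ren Γ Δ) (ρ' : Ren Δ Θ) (t : Tm Θ A) →
          ren ρ (ren ρ' t) ≡ ren (λ x → ρ (ρ' x)) t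
ren-ren ρ ρ' (var x)    = refl
ren-ren ρ ρ' (lam t)    =
  cong lam (trans (ren-ren (liftR ρ) (liftR ρ') t) (ren-cong e t))
  where
  e : ∀ {B} x → liftR ρ (liftR {A = _} ρ' {B} x) ≡ liftR (λ y → ρ (ρ' y)) x
  e here      = refl
  e (there x) = refl
ren-ren ρ ρ' (app t u)  = cong₂ app (ren-ren ρ ρ' t) (ren-ren ρ ρ' u)
ren-ren ρ ρ' unit       = refl
ren-ren ρ ρ' (pair t u) = cong₂ pair (ren-ren ρ ρ' t) (ren-ren ρ ρ' u)
ren-ren ρ ρ' (fst t)    = cong fst (ren-ren ρ ρ' t)
ren-ren ρ ρ' (snd t)    = cong snd (ren-ren ρ ρ' t)

sub-cong : ∀ {Γ Δ A} {σ σ' : Sub Γ Δ} → (∀ {B} (x : Δ ∋ B) → σ x ≡ σ' x) →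
           (t : Tm Δ A) → sub σ t ≡ sub σ' t
sub-cong e (var x)    = e x
sub-cong {σ = σ} {σ'} e (lam t) = cong lam (sub-cong e' t)
  where
  e' : ∀ {B} x → liftS {A = _} σ {B} x ≡ liftS σ' x
  e' here      = refl
  e' (there x) = cong (ren there) (e x)
sub-cong e (app t u)  = cong₂ app (sub-cong e t) (sub-cong e u)
sub-cong e unit       = refl
sub-cong e (pair t u) = cong₂ pair (sub-cong e t) (sub-cong e u)
sub-cong e (fst t)    = cong fst (sub-cong e t)
sub-cong e (snd t)    = cong snd (sub-cong e t)

ren-sub : ∀ {Γ Δ Θ A} (ρ : Ren Γ Δ) (σ : Sub Δ Θ) (t : Tm Θ A) →
          ren ρ (sub σ t) ≡ sub (λ x → ren ρ (σ x)) t
ren-sub ρ σ (var x)    = refl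
ren-sub ρ σ (lam t)    =
  cong lam (trans (ren-sub (liftR ρ) (liftS σ) t) (sub-cong e t))
  where
  e : ∀ {B} x → ren (liftR ρ) (liftS {A = _} σ {B} x) ≡ liftS (λ y → ren ρ (σ y)) x
  e here      = refl
  e (there x) = trans (ren-ren (liftR ρ) there (σ x))
                      (sym (ren-ren there ρ (σ x)))
ren-sub ρ σ (app t u)  = cong₂ app (ren-sub ρ σ t) (ren-sub ρ σ u)
ren-sub ρ σ unit       = refl
ren-sub ρ σ (pair t u) = cong₂ pair (ren-sub ρ σ t) (ren-sub ρ σ u)
ren-sub ρ σ (fst t)    = cong fst (ren-sub ρ σ t)
ren-sub ρ σ (snd t)    = cong snd (ren-sub ρ σ t)

sub-ren : ∀ {Γ Δ Θ A} (σ : Sub Γ Δ) (ρ : Ren Δ Θ) (t : Tm Θ A) →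
          sub σ (ren ρ t) ≡ sub (λ x → σ (ρ x)) t
sub-ren σ ρ (var x)    = refl
sub-ren σ ρ (lam t)    =
  cong lam (trans (sub-ren (liftS σ) (liftR ρ) t) (sub-cong e t))
  where
  e : ∀ {B} x → liftS σ (liftR {A = _} ρ {B} x) ≡ liftS (λ y → σ (ρ y)) x
  e here      = refl
  e (there x) = refl
sub-ren σ ρ (app t u)  = cong₂ app (sub-ren σ ρ t) (sub-ren σ ρ u)
sub-ren σ ρ unit       = refl
sub-ren σ ρ (pair t u) = cong₂ pair (sub-ren σ ρ t) (sub-ren σ ρ u)
sub-ren σ ρ (fst t)    = cong fst (sub-ren σ ρ t)
sub-ren σ ρ (snd t)    = cong snd (sub-ren σ ρ t)

sub-sub : ∀ {Γ Δ Θ A} (τ : Sub Γ Δ) (σ : Sub Δ Θ) (t : Tm Θ A) →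
          sub τ (sub σ t) ≡ sub (λ x → sub τ (σ x)) t
sub-sub τ σ (var x)    = refl
sub-sub τ σ (lam t)    =
  cong lam (trans (sub-sub (liftS τ) (liftS σ) t) (sub-cong e t))
  where
  e : ∀ {B} x → sub (liftS τ) (liftS {A = _} σ {B} x) ≡ liftS (λ y → sub τ (σ y)) x
  e here      = refl
  e (there x) = trans (sub-ren (liftS τ) there (σ x))
                      (sym (ren-sub there τ (σ x)))
sub-sub τ σ (app t u)  = cong₂ app (sub-sub τ σ t) (sub-sub τ σ u)
sub-sub τ σ unit       = refl
sub-sub τ σ (pair t u) = cong₂ pair (sub-sub τ σ t) (sub-sub τ σ u)
sub-sub τ σ (fst t)    = cong fst (sub-sub τ σ t)
sub-sub τ σ (snd t)    = cong snd (sub-sub τ σ t)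

ren-≈ : ∀ {Γ Δ A} (ρ : Ren Γ Δ) {t u : Tm Δ A} → t ≈ u → ren ρ t ≈ ren ρ u
ren-≈ ρ ≈refl            = ≈refl
ren-≈ ρ (≈sym p)         = ≈sym (ren-≈ ρ p)
ren-≈ ρ (≈trans p q)     = ≈trans (ren-≈ ρ p) (ren-≈ ρ q)
ren-≈ ρ (lam-cong p)     = lam-cong (ren-≈ (liftR ρ) p)
ren-≈ ρ (app-cong p q)   = app-cong (ren-≈ ρ p) (ren-≈ ρ q)
ren-≈ ρ (pair-cong p q)  = pair-cong (ren-≈ ρ p) (ren-≈ ρ q)
ren-≈ ρ (fst-cong p)     = fst-cong (ren-≈ ρ p)
ren-≈ ρ (snd-cong p)     = snd-cong (ren-≈ ρ p)
ren-≈ ρ (β⇒ t u)         =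
  ≈trans (β⇒ _ _)
    (≡→≈ (trans (sub-ren (single (ren ρ u)) (liftR ρ) t)
         (trans (sub-cong e t) (sym (ren-sub ρ (single u) t)))))
  where
  e : ∀ {B} x → single (ren ρ u) (liftR ρ {B} x) ≡ ren ρ (single u x)
  e here      = refl
  e (there x) = refl
ren-≈ ρ (η⇒ t)           =
  ≈trans (η⇒ _)
    (≡→≈ (cong (λ s → lam (app s (var here)))
      (trans (ren-ren there ρ t)
        (trans (ren-cong (λ x → refl) t) (sym (ren-ren (liftR ρ) there t))))))
ren-≈ ρ (β⊗₁ t u)        = β⊗₁ _ _
ren-≈ ρ (β⊗₂ t u)        = β⊗₂ _ _
ren-≈ ρ (η⊗ t)           = η⊗ _
ren-≈ ρ (η𝟙 t)           = η𝟙 _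

-- The category 𝔻: objects are contexts, morphisms Ψ → Φ are
-- substitutions Sub Ψ Φ modulo (pointwise) αβη-conversion.

Obj : Set
Obj = Ctx

_≈S_ : ∀ {Ψ Φ} → Sub Ψ Φ → Sub Ψ Φ → Set
_≈S_ {Φ = Φ} σ σ' = ∀ {A} (x : Φ ∋ A) → σ x ≈ σ' x

idS : ∀ {Ψ} → Sub Ψ Ψ
idS = var

_∘S_ : ∀ {Ψ Φ Θ} → Sub Φ Θ → Sub Ψ Φ → Sub Ψ Θ
(τ ∘S σ) x = sub σ (τ x)

sub-cong-≈ : ∀ {Γ Δ A} {σ σ' : Sub Γ Δ} → σ ≈S σ' → (t : Tm Δ A) →
             sub σ t ≈ sub σ' t
sub-cong-≈ e (var x)    = e x
sub-cong-≈ {σ = σ} {σ'} e (lam t) = lam-cong (sub-cong-≈ e' t)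
  where
  e' : liftS {A = _} σ ≈S liftS σ'
  e' here      = ≈refl
  e' (there x) = ren-≈ there (e x)
sub-cong-≈ e (app t u)  = app-cong (sub-cong-≈ e t) (sub-cong-≈ e u)
sub-cong-≈ e unit       = ≈refl
sub-cong-≈ e (pair t u) = pair-cong (sub-cong-≈ e t) (sub-cong-≈ e u)
sub-cong-≈ e (fst t)    = fst-cong (sub-cong-≈ e t)
sub-cong-≈ e (snd t)    = snd-cong (sub-cong-≈ e t)

prodTy : Ctx → Ty
prodTy []      = 𝟙
prodTy (A ∷ Γ) = prodTy Γ ⊗ A

-- code of the exponential of a and b in 𝔻 (the function type)
arrow : Obj → Obj → Obj
arrow a b = (prodTy a ⇒ prodTy b) ∷ []

record Psh : Set₁ where
  field
    Fo   : Ctx → Set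
    _≈ₚ_ : ∀ {Ψ} → Fo Ψ → Fo Ψ → Set
    isEq : ∀ {Ψ} → IsEquivalence (_≈ₚ_ {Ψ})
    act  : ∀ {Ψ Φ} → Sub Ψ Φ → Fo Φ → Fo Ψ

open Psh public

-- El a = y(a): El a (Ψ) = 𝔻(Ψ , a), action by precomposition
El : Obj → Psh
El a = record
  { Fo   = λ Ψ → Sub Ψ a
  ; _≈ₚ_ = _≈S_
  ; isEq = record { refl  = λ x → ≈refl
                  ; sym   = λ p x → ≈sym (p x)
                  ; trans = λ p q x → ≈trans (p x) (q x) }
  ; act  = λ σ f → f ∘S σ
  }

-- Elements at stage Ψ of the presheaf exponential P ⇛ Q:
-- natural transformations y(Ψ) × P → Q (respecting the setoid equalities).
record ExpEl (P Q : Psh) (Ψ : Ctx) : Set where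
  field
    fun      : ∀ {Φ} → Sub Φ Ψ → Fo P Φ → Fo Q Φ
    fun-cong : ∀ {Φ} {σ σ' : Sub Φ Ψ} {p p' : Fo P Φ} →
               σ ≈S σ' → _≈ₚ_ P p p' → _≈ₚ_ Q (fun σ p) (fun σ' p')
    natural  : ∀ {Φ Φ'} (σ : Sub Φ Ψ) (ρ : Sub Φ' Φ) (p : Fo P Φ) →
               _≈ₚ_ Q (fun (σ ∘S ρ) (act P ρ p)) (act Q ρ (fun σ p))

open ExpEl public

infixr 5 _⇛_
_⇛_ : Psh → Psh → Psh
P ⇛ Q = record
  { Fo   = ExpEl P Q
  ; _≈ₚ_ = λ {Ψ} h h' → ∀ {Φ} (σ : Sub Φ Ψ) (p : Fo P Φ) →
                          _≈ₚ_ Q (fun h σ p) (fun h' σ p)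
  ; isEq = record
      { refl  = λ σ p → IsEquivalence.refl (isEq Q)
      ; sym   = λ e σ p → IsEquivalence.sym (isEq Q) (e σ p)
      ; trans = λ e e' σ p → IsEquivalence.trans (isEq Q) (e σ p) (e' σ p) }
  ; act  = λ τ h → record
      { fun      = λ σ p → fun h (τ ∘S σ) p
      ; fun-cong = λ σ≈ p≈ → fun-cong h (λ x → sub-cong-≈ σ≈ (τ x)) p≈
      ; natural  = λ σ ρ p →
          IsEquivalence.trans (isEq Q)
            (fun-cong h (λ x → ≡→≈ (sym (sub-sub ρ σ (τ x))))
                        (IsEquivalence.refl (isEq P)))
            (natural h (τ ∘S σ) ρ p)
      }
  }

-- Internal type theory, restricted to the context  c : Obj , d : Obj.
-- Obj is the constant presheaf (trivial action), so a type in this context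
-- is a family  T c d  of presheaves on 𝔻, and a term of type T is a
-- section: a family of elements at every stage, natural in the stage.

record Term (T : Obj → Obj → Psh) : Set where
  field
    at  : (c d : Obj) (Ψ : Ctx) → Fo (T c d) Ψ
    nat : (c d : Obj) {Ψ Φ : Ctx} (τ : Sub Φ Ψ) →
          _≈ₚ_ (T c d) (act (T c d) τ (at c d Ψ)) (at c d Φ)

open Term public

-- interpretation of application  t u  at stage Ψ:  t(Ψ).fun id (u(Ψ))
appI : ∀ {P Q Ψ} → Fo (P ⇛ Q) Ψ → Fo P Ψ → Fo Q Ψ
appI h p = fun h idS p

ArrowETy : Obj → Obj → Psh
ArrowETy c d = El (arrow c d) ⇛ (El c ⇛ El d)

ArrowITy : Obj → Obj → Psh
ArrowITy c d = (El c ⇛ El d) ⇛ El (arrow c d)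

-- El (arrow c d) is the presheaf represented by the function type prodTy c ⇒ prodTy d,
-- and a natural transformation y c → y d over stage Ψ is determined by its value on the
-- generic element of El c at the stage prodTy c ∷ Ψ. Abstracting that value (with λ) and
-- applying a function term to a tuple are mutually inverse by β and η, once substitutions
-- into a context are identified with terms of its product type (β⊗, η⊗, η𝟙).
module Submission where

open import Defs
open import Data.Product using (Σ; _×_; _,_)
open import Data.List using ([]; _∷_)
open import Relation.Binary.PropositionalEquality
  using (_≡_; refl; cong; cong₂; trans; sym; module ≡-Reasoning)
open import Relation.Binary.Structures using (IsEquivalence)
open import Relation.Binary.Bundles using (Setoid)

sub-id : ∀ {Γ A} (t : Tm Γ A) → sub idS t ≡ t
sub-id (var x)    = refl
sub-id (lam t)    = cong lam (trans (sub-cong liftS-id t) (sub-id t))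
  where
  liftS-id : ∀ {B} x → liftS {A = _} idS {B} x ≡ idS x
  liftS-id here      = refl
  liftS-id (there x) = refl
sub-id (app t u)  = cong₂ app (sub-id t) (sub-id u)
sub-id unit       = refl
sub-id (pair t u) = cong₂ pair (sub-id t) (sub-id u)
sub-id (fst t)    = cong fst (sub-id t)
sub-id (snd t)    = cong snd (sub-id t)

sub-var : ∀ {Γ Δ A} (ρ : Ren Γ Δ) (t : Tm Δ A) → sub (λ x → var (ρ x)) t ≡ ren ρ t
sub-var ρ (var x)    = refl
sub-var ρ (lam t)    = cong lam (trans (sub-cong liftS-var t) (sub-var (liftR ρ) t))
  where
  liftS-var : ∀ {B} x → liftS {A = _} (λ y → var (ρ y)) {B} x ≡ var (liftR ρ x)
  liftS-var here      = refl
  liftS-var (there x) = refl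
sub-var ρ (app t u)  = cong₂ app (sub-var ρ t) (sub-var ρ u)
sub-var ρ unit       = refl
sub-var ρ (pair t u) = cong₂ pair (sub-var ρ t) (sub-var ρ u)
sub-var ρ (fst t)    = cong fst (sub-var ρ t)
sub-var ρ (snd t)    = cong snd (sub-var ρ t)

single-ren-there : ∀ {Γ A B} (u : Tm Γ A) (t : Tm Γ B) → sub (single u) (ren there t) ≡ t
single-ren-there u t = trans (sub-ren (single u) there t) (sub-id t)

sub-≈ : ∀ {Γ Δ A} (σ : Sub Γ Δ) {t u : Tm Δ A} → t ≈ u → sub σ t ≈ sub σ u
sub-≈ σ ≈refl           = ≈refl
sub-≈ σ (≈sym p)        = ≈sym (sub-≈ σ p)
sub-≈ σ (≈trans p q)    = ≈trans (sub-≈ σ p) (sub-≈ σ q)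
sub-≈ σ (lam-cong p)    = lam-cong (sub-≈ (liftS σ) p)
sub-≈ σ (app-cong p q)  = app-cong (sub-≈ σ p) (sub-≈ σ q)
sub-≈ σ (pair-cong p q) = pair-cong (sub-≈ σ p) (sub-≈ σ q)
sub-≈ σ (fst-cong p)    = fst-cong (sub-≈ σ p)
sub-≈ σ (snd-cong p)    = snd-cong (sub-≈ σ p)
sub-≈ σ (β⇒ t u)        = ≈trans (β⇒ _ _) (≡→≈ (begin
    sub (single (sub σ u)) (sub (liftS σ) t)   ≡⟨ sub-sub _ (liftS σ) t ⟩
    sub (λ x → sub (single (sub σ u)) (liftS σ x)) t
                                              ≡⟨ sub-cong single-liftS t ⟩
    sub (λ x → sub σ (single u x)) t          ≡⟨ sub-sub σ (single u) t ⟨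
    sub σ (t [ u ])                           ∎))
  where
  open ≡-Reasoning
  single-liftS : ∀ {B} x → sub (single (sub σ u)) (liftS σ {B} x) ≡ sub σ (single u x)
  single-liftS here      = refl
  single-liftS (there x) = single-ren-there (sub σ u) (σ x)
sub-≈ σ (η⇒ t)          =
  ≈trans (η⇒ _)
    (≡→≈ (cong (λ s → lam (app s (var here)))
      (trans (ren-sub there σ t) (sym (sub-ren (liftS σ) there t)))))
sub-≈ σ (β⊗₁ t u)       = β⊗₁ _ _
sub-≈ σ (β⊗₂ t u)       = β⊗₂ _ _
sub-≈ σ (η⊗ t)          = η⊗ _
sub-≈ σ (η𝟙 t)          = η𝟙 _

≈-setoid : Ctx → Ty → Setoid _ _
≈-setoid Γ A = record
  { Carrier       = Tm Γ A
  ; _≈_           = _≈_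
  ; isEquivalence = record { refl = ≈refl ; sym = ≈sym ; trans = ≈trans }
  }

tuple : ∀ {Γ} c → Sub Γ c → Tm Γ (prodTy c)
tuple []      s = unit
tuple (A ∷ c) s = pair (tuple c (λ x → s (there x))) (s here)

untuple : ∀ {Γ} c → Tm Γ (prodTy c) → Sub Γ c
untuple (A ∷ c) t here      = snd t
untuple (A ∷ c) t (there x) = untuple c (fst t) x

tuple-cong : ∀ {Γ} c {s s' : Sub Γ c} → s ≈S s' → tuple c s ≈ tuple c s'
tuple-cong []      e = ≈refl
tuple-cong (A ∷ c) e = pair-cong (tuple-cong c (λ x → e (there x))) (e here)

untuple-cong : ∀ {Γ} c {t t' : Tm Γ (prodTy c)} → t ≈ t' → untuple c t ≈S untuple c t'
untuple-cong (A ∷ c) e here      = snd-cong e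
untuple-cong (A ∷ c) e (there x) = untuple-cong c (fst-cong e) x

untuple-tuple : ∀ {Γ} c (s : Sub Γ c) → untuple c (tuple c s) ≈S s
untuple-tuple (A ∷ c) s here      = β⊗₂ _ _
untuple-tuple (A ∷ c) s (there x) =
  ≈trans (untuple-cong c (β⊗₁ _ _) x) (untuple-tuple c (λ y → s (there y)) x)

tuple-untuple : ∀ {Γ} c (t : Tm Γ (prodTy c)) → tuple c (untuple c t) ≈ t
tuple-untuple []      t = ≈sym (η𝟙 t)
tuple-untuple (A ∷ c) t = ≈trans (pair-cong (tuple-untuple c (fst t)) ≈refl) (≈sym (η⊗ t))

sub-tuple : ∀ {Γ Δ} c (τ : Sub Γ Δ) (s : Sub Δ c) →
            sub τ (tuple c s) ≡ tuple c (s ∘S τ)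
sub-tuple []      τ s = refl
sub-tuple (A ∷ c) τ s = cong₂ pair (sub-tuple c τ (λ x → s (there x))) refl

sub-untuple : ∀ {Γ Δ} c (τ : Sub Γ Δ) (t : Tm Δ (prodTy c)) →
              (untuple c t ∘S τ) ≈S untuple c (sub τ t)
sub-untuple (A ∷ c) τ t here      = ≈refl
sub-untuple (A ∷ c) τ t (there x) = sub-untuple c τ (fst t) x

record _⟶_ (P Q : Psh) : Set where
  field
    map         : ∀ {Ψ} → Fo P Ψ → Fo Q Ψ
    map-cong    : ∀ {Ψ} {p p' : Fo P Ψ} → _≈ₚ_ P p p' → _≈ₚ_ Q (map p) (map p')
    map-natural : ∀ {Ψ Φ} (ρ : Sub Φ Ψ) (p : Fo P Ψ) →
                  _≈ₚ_ Q (map (act P ρ p)) (act Q ρ (map p))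

open _⟶_

homTerm : {P Q : Obj → Obj → Psh} → ((c d : Obj) → P c d ⟶ Q c d) →
          Term (λ c d → P c d ⇛ Q c d)
homTerm {Q = Q} h = record
  { at  = λ c d Ψ → record
      { fun      = λ σ p → map (h c d) p
      ; fun-cong = λ σ≈σ' p≈p' → map-cong (h c d) p≈p'
      ; natural  = λ σ ρ p → map-natural (h c d) ρ p
      }
  ; nat = λ c d τ σ p → IsEquivalence.refl (isEq (Q c d))
  }

fun-restrict : ∀ {P Q Ψ Φ Φ'} (g : ExpEl P Q Ψ) {σ : Sub Φ Ψ} {ρ : Sub Φ' Φ}
               {σ' : Sub Φ' Ψ} {p : Fo P Φ} {p' : Fo P Φ'} →
               σ' ≈S (σ ∘S ρ) → _≈ₚ_ P p' (act P ρ p) →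
               _≈ₚ_ Q (fun g σ' p') (act Q ρ (fun g σ p))
fun-restrict {Q = Q} g {σ} {ρ} {p = p} σ'≈ p'≈ =
  IsEquivalence.trans (isEq Q) (fun-cong g σ'≈ p'≈) (natural g σ ρ p)

module _ (c d : Obj) where

  applyArrow : ∀ {Φ} → Tm Φ (prodTy c ⇒ prodTy d) → Sub Φ c → Sub Φ d
  applyArrow t p = untuple d (app t (tuple c p))

  applyArrow-cong : ∀ {Φ} {t t' : Tm Φ (prodTy c ⇒ prodTy d)} {p p' : Sub Φ c} →
                    t ≈ t' → p ≈S p' → applyArrow t p ≈S applyArrow t' p'
  applyArrow-cong t≈t' p≈p' = untuple-cong d (app-cong t≈t' (tuple-cong c p≈p'))

  sub-applyArrow : ∀ {Φ Φ'} (ρ : Sub Φ' Φ) (t : Tm Φ (prodTy c ⇒ prodTy d)) (p : Sub Φ c) →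
                   (applyArrow t p ∘S ρ) ≈S applyArrow (sub ρ t) (p ∘S ρ)
  sub-applyArrow ρ t p x =
    ≈trans (sub-untuple d ρ _ x)
      (≡→≈ (cong (λ u → untuple d (app (sub ρ t) u) x) (sub-tuple c ρ p)))

  toExp : ∀ {Ψ} → Sub Ψ (arrow c d) → ExpEl (El c) (El d) Ψ
  toExp f = record
    { fun      = λ σ p → applyArrow (sub σ (f here)) p
    ; fun-cong = λ σ≈σ' p≈p' → applyArrow-cong (sub-cong-≈ σ≈σ' (f here)) p≈p'
    ; natural  = λ σ ρ p x →
        ≈trans (≡→≈ (cong (λ t → applyArrow t (p ∘S ρ) x) (sym (sub-sub ρ σ (f here)))))
               (≈sym (sub-applyArrow ρ (sub σ (f here)) p x))
    }

  generic : ∀ {Φ} → Sub (prodTy c ∷ Φ) c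
  generic = untuple c (var here)

  weaken : ∀ {Φ} → Sub (prodTy c ∷ Φ) Φ
  weaken x = var (there x)

  fromExp : ∀ {Ψ} → ExpEl (El c) (El d) Ψ → Sub Ψ (arrow c d)
  fromExp g here = lam (tuple d (fun g weaken generic))

  toExp-hom : El (arrow c d) ⟶ (El c ⇛ El d)
  toExp-hom = record
    { map         = toExp
    ; map-cong    = λ f≈f' σ p → applyArrow-cong (sub-≈ σ (f≈f' here)) (λ x → ≈refl)
    ; map-natural = λ ρ f σ p x →
        ≡→≈ (cong (λ t → applyArrow t p x) (sub-sub σ ρ (f here)))
    }

  fromExp-natural : ∀ {Ψ Φ} (ρ : Sub Φ Ψ) (g : ExpEl (El c) (El d) Ψ) →
                    fromExp (act (El c ⇛ El d) ρ g) ≈S (fromExp g ∘S ρ)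
  fromExp-natural ρ g here = lam-cong (≈trans
      (tuple-cong d (fun-restrict g weaken-liftS generic-liftS))
      (≡→≈ (sym (sub-tuple d (liftS ρ) (fun g weaken generic)))))
    where
    weaken-liftS : (ρ ∘S weaken) ≈S (weaken ∘S liftS ρ)
    weaken-liftS y = ≡→≈ (sub-var there (ρ y))
    generic-liftS : generic ≈S (generic ∘S liftS ρ)
    generic-liftS y = ≈sym (sub-untuple c (liftS ρ) (var here) y)

  fromExp-hom : (El c ⇛ El d) ⟶ El (arrow c d)
  fromExp-hom = record
    { map         = fromExp
    ; map-cong    = λ g≈g' → λ { here → lam-cong (tuple-cong d (g≈g' weaken generic)) }
    ; map-natural = fromExp-natural
    }

  fromExp-toExp : ∀ {Ψ} (f : Sub Ψ (arrow c d)) → fromExp (toExp f) ≈S f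
  fromExp-toExp f here = ≈trans
      (lam-cong (≈trans (tuple-untuple d _)
        (app-cong (≡→≈ (sub-var there (f here))) (tuple-untuple c (var here)))))
      (≈sym (η⇒ (f here)))

  toExp-fromExp : ∀ {Ψ} (g : ExpEl (El c) (El d) Ψ) →
                  _≈ₚ_ (El c ⇛ El d) (toExp (fromExp g)) g
  toExp-fromExp g {Φ} σ p {B} x = begin
    applyArrow (lam (sub (liftS σ) body)) p x
      ≈⟨ untuple-cong d (β⇒ _ _) x ⟩
    untuple d (sub (single (tuple c p)) (sub (liftS σ) body)) x
      ≡⟨ cong (λ t → untuple d t x)
              (trans (sub-sub _ (liftS σ) body) (sub-tuple d τ (fun g weaken generic))) ⟩
    untuple d (tuple d (fun g weaken generic ∘S τ)) x
      ≈⟨ untuple-tuple d _ x ⟩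
    (fun g weaken generic ∘S τ) x
      ≈⟨ ≈sym (fun-restrict g weaken-τ generic-τ x) ⟩
    fun g σ p x
      ∎
    where
    open import Relation.Binary.Reasoning.Setoid (≈-setoid Φ B)
    body : Tm (prodTy c ∷ _) (prodTy d)
    body = tuple d (fun g weaken generic)
    τ : Sub Φ (prodTy c ∷ _)
    τ y = sub (single (tuple c p)) (liftS σ y)
    weaken-τ : σ ≈S (weaken ∘S τ)
    weaken-τ y = ≡→≈ (sym (single-ren-there (tuple c p) (σ y)))
    generic-τ : p ≈S (generic ∘S τ)
    generic-τ y = ≈sym (≈trans (sub-untuple c τ (var here) y) (untuple-tuple c p y))

arrow-e : Term ArrowETy
arrow-e = homTerm toExp-hom

arrow-i : Term ArrowITy
arrow-i = homTerm fromExp-hom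

lemma4p4 : Σ (Term ArrowETy) (λ arrow-e → Σ (Term ArrowITy) (λ arrow-i →
             ((c d : Obj) (Ψ : Ctx) (f : Fo (El (arrow c d)) Ψ) →
                _≈ₚ_ (El (arrow c d))
                  (appI {El c ⇛ El d} {El (arrow c d)} (at arrow-i c d Ψ)
                    (appI {El (arrow c d)} {El c ⇛ El d} (at arrow-e c d Ψ) f))
                  f)
           × ((c d : Obj) (Ψ : Ctx) (g : Fo (El c ⇛ El d) Ψ) →
                _≈ₚ_ (El c ⇛ El d)
                  (appI {El (arrow c d)} {El c ⇛ El d} (at arrow-e c d Ψ)
                    (appI {El c ⇛ El d} {El (arrow c d)} (at arrow-i c d Ψ) g))
                  g)))
lemma4p4 = arrow-e , arrow-i
         , (λ c d Ψ → fromExp-toExp c d)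
         , (λ c d Ψ → toExp-fromExp c d)
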